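{- Let $q$ be a prime power, $t$ a positive integer, and $m\ge n\ge1$ integers; let $\mathbf{n}=(n,1,\dots,1)$ and $\mathbf{m}=(m,1,\dots,1)$ (length $t$). Suppose there exists an MSRD code $\mathcal{C}\subseteq\operatorname{Mat}(\mathbf{n},\mathbf{m},\mathbb{F}_q)$ (not necessarily linear) of minimum distance $d=3$. Then $$t\le\begin{cases}1+q^m & \text{if } n=1,\\[2pt] \dfrac{q^{2m}-q^{m+1}-q^m+2q-1}{q-1} & \text{if } n=2,\\[6pt] \dfrac{q^{2m+1}-q^{2m}-q^{m+n}+q^m+q^n+q^2-3q+1}{(q-1)^2} & \text{if } n>2.\end{cases}$$
   Context: $\operatorname{Mat}(\mathbf{n},\mathbf{m},\mathbb{F}_q)=\bigoplus_{i=1}^t\mathbb{F}_q^{n_i\times m_i}$ with sum-rank $\mathrm{srk}(X)=\sum_i\mathrm{rk}(X_i)$ and distance $\mathrm{srk}(X-Y)$. A code is a subset $\mathcal{C}$ with $|\mathcal{C}|\ge2$; its minimum distance is the least sum-rank distance between distinct codewords. The Singleton bound states that a code with minimum distance $d$ satisfies $|\mathcal{C}|\le q^{\sum_{i=j}^t m_in_i-m_j\delta}$, where $j,\delta$ are the unique integers with $d-1=\sum_{i=1}^{j-1}n_i+\delta$ and $0\le\delta\le n_j-1$; an MSRD code is a code attaining this bound with equality (for the present parameters and $d=3$: $|\mathcal{C}|=q^{t-2}$ if $n=1$, $q^{t-1}$ if $n=2$, $q^{m(n-2)+t-1}$ if $n>2$). -}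

module Defs where

open import Level using (Level; _⊔_)
open import Algebra.Bundles using (CommutativeRing)
open import Data.Nat as ℕ using (ℕ; zero; suc; _≤_; _<?_; _∸_)
open import Data.Fin using (Fin; zero; suc)
open import Data.Product using (Σ; ∃; _×_; _,_)
open import Relation.Nullary using (¬_; yes; no)
open import Relation.Binary.PropositionalEquality using (_≡_; _≢_)

∑ℕ : ∀ {k} → (Fin k → ℕ) → ℕ
∑ℕ {zero}  f = 0
∑ℕ {suc k} f = f zero ℕ.+ ∑ℕ (λ i → f (suc i))

module _ {c ℓ : Level} (R : CommutativeRing c ℓ) where
  open CommutativeRing R using (_≈_; _+_; _*_; _-_; 0#; 1#) renaming (Carrier to A)

  ∑ : ∀ {k} → (Fin k → A) → A
  ∑ {zero}  f = 0#
  ∑ {suc k} f = f zero + ∑ (λ i → f (suc i))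

  IsField : Set (c ⊔ ℓ)
  IsField = (¬ (0# ≈ 1#)) × (∀ x → ¬ (x ≈ 0#) → ∃ λ y → (x * y) ≈ 1#)

  HasSize : ℕ → Set (c ⊔ ℓ)
  HasSize q = Σ (Fin q → A) λ e →
                (∀ i j → e i ≈ e j → i ≡ j) × (∀ x → ∃ λ i → e i ≈ x)

  Matrix : ℕ → ℕ → Set c
  Matrix r s = Fin r → Fin s → A

  LinIndep : ∀ {k s} → (Fin k → Fin s → A) → Set (c ⊔ ℓ)
  LinIndep {k} {s} v =
    ∀ (a : Fin k → A) → (∀ j → ∑ (λ i → a i * v i j) ≈ 0#) → ∀ i → a i ≈ 0#

  HasIndepRows : ∀ {r s} → Matrix r s → ℕ → Set (c ⊔ ℓ)
  HasIndepRows {r} {s} X k = Σ (Fin k → Fin r) λ σ →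
    (∀ i j → σ i ≡ σ j → i ≡ j) × LinIndep (λ i → X (σ i))

  HasRank : ∀ {r s} → Matrix r s → ℕ → Set (c ⊔ ℓ)
  HasRank X k = HasIndepRows X k × (∀ k′ → HasIndepRows X k′ → k′ ≤ k)

  Mat : ∀ {t} → (Fin t → ℕ) → (Fin t → ℕ) → Set c
  Mat {t} N M = (i : Fin t) → Matrix (N i) (M i)

  _-ᴹ_ : ∀ {t} {N M : Fin t → ℕ} → Mat N M → Mat N M → Mat N M
  (X -ᴹ Y) i a b = X i a b - Y i a b

  _≈ᴹ_ : ∀ {t} {N M : Fin t → ℕ} → Mat N M → Mat N M → Set ℓ
  X ≈ᴹ Y = ∀ i a b → X i a b ≈ Y i a b

  HasSumRank : ∀ {t} {N M : Fin t → ℕ} → Mat N M → ℕ → Set (c ⊔ ℓ)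
  HasSumRank {t} X s = Σ (Fin t → ℕ) λ rk →
    (∀ i → HasRank (X i) (rk i)) × s ≡ ∑ℕ rk

  record Code {t} (N M : Fin t → ℕ) (d : ℕ) : Set (c ⊔ ℓ) where
    field
      size      : ℕ
      word      : Fin size → Mat N M
      atLeast2  : 2 ≤ size
      distinct  : ∀ i j → i ≢ j → ¬ (word i ≈ᴹ word j)
      distLower : ∀ i j → i ≢ j → ∀ s → HasSumRank (word i -ᴹ word j) s → d ≤ s
      distAttained : Σ (Fin size) λ i → Σ (Fin size) λ j →
                       i ≢ j × HasSumRank (word i -ᴹ word j) d

-- Singleton exponent ∑_{i=j}^t m_i n_i − m_j δ, where
-- k = d − 1 = ∑_{i<j} n_i + δ, 0 ≤ δ ≤ n_j − 1.
-- (If k ≥ ∑ n_i no such j exists; we then return 0, no code can exist.)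
singletonExp : ∀ {t} → ℕ → (Fin t → ℕ) → (Fin t → ℕ) → ℕ
singletonExp {zero}  k N M = 0
singletonExp {suc t} k N M with k <? N zero
... | yes _ = (M zero ℕ.* N zero ∸ M zero ℕ.* k)
              ℕ.+ ∑ℕ (λ i → M (suc i) ℕ.* N (suc i))
... | no  _ = singletonExp (k ∸ N zero) (λ i → N (suc i)) (λ i → M (suc i))

IsMSRD : ∀ {c ℓ} (R : CommutativeRing c ℓ) (q : ℕ) {t} {N M : Fin t → ℕ} {d : ℕ}
         → Code R N M d → Set
IsMSRD R q {N = N} {M} {d} C = Code.size C ≡ q ℕ.^ singletonExp (d ∸ 1) N M

firstThen1 : ∀ {t} → ℕ → Fin t → ℕ
firstThen1 n zero    = n
firstThen1 n (suc _) = 1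

-- Distinct codewords have disjoint balls of radius 1, since a
-- common point would put them at sum-rank distance at most 2 < 3. In Mat((n,1,…,1),(m,1,…,1)) such a
-- ball consists of its centre, the (qⁿ − 1)(qᵐ − 1)/(q − 1) rank-one changes of the n × m block and the
-- (t − 1)(q − 1) changes of a single scalar block. Hence |C| times this ball size is at most q^(mn + t − 1);
-- inserting the Singleton size of an MSRD code and rearranging gives the three bounds.
{-# OPTIONS --safe #-}
module Submission where

open import Defs
open import Level using (Level; _⊔_)
open import Algebra.Bundles using (CommutativeRing)
open import Data.Empty using (⊥-elim)
open import Data.Fin as Fin using (Fin; zero; suc; remQuot)
import Data.Fin.Properties as FinP
open import Data.Integer as ℤ using (ℤ; +_)
import Data.Integer.Properties as ℤP
import Data.Integer.Tactic.RingSolver as ℤSolver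
open import Data.Maybe using (Maybe; just; nothing)
open import Data.Nat as ℕ using (ℕ; zero; suc; _≤_; _>_; z≤n; s≤s; _^_; _∸_; NonZero)
import Data.Nat.Properties as ℕP
open import Data.Nat.Tactic.RingSolver using (solve-∀)
open import Algebra.Properties.CommutativeSemigroup ℕP.+-commutativeSemigroup
  using () renaming (interchange to +-interchange)
open import Data.Product using (Σ; ∃; _×_; _,_; proj₁; proj₂)
open import Data.Product.Function.NonDependent.Propositional using (_×-↔_)
open import Data.Product.Properties using (×-≡,≡→≡)
open import Data.Sum using (_⊎_; inj₁; inj₂; [_,_]′)
open import Data.Sum.Function.Propositional using (_⊎-↔_)
open import Data.Unit using (⊤; tt)
open import Data.Vec.Functional using (_∷_; updateAt)
open import Data.Vec.Functional.Properties using (updateAt-updates; updateAt-minimal)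
open import Function using (_∘_; _$_)
open import Function.Bundles using (Injection; Inverse; _↔_)
open import Function.Properties.Inverse using (↔⇒↣; ↔-trans; ↔-refl)
open import Relation.Binary.PropositionalEquality as ≡ using (_≡_; refl; cong; cong₂; subst₂)
open import Relation.Nullary
  using (¬_; yes; no; DoubleNegation; ¬¬-excluded-middle; ¬¬-map; decidable-stable; contradiction)

private variable a b p : Level

infixl 1 _¬¬>>=_
_¬¬>>=_ : {P : Set a} {Q : Set b} → DoubleNegation P → (P → DoubleNegation Q) → DoubleNegation Q
(¬¬p ¬¬>>= f) ¬q = ¬¬p λ p → f p ¬q

¬¬-return : {P : Set a} → P → DoubleNegation P
¬¬-return p ¬p = ¬p p

¬¬-finiteChoice : ∀ {t} (Q : Fin t → ℕ → Set p) → (∀ l → DoubleNegation (Σ ℕ (Q l)))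
                → DoubleNegation (Σ (Fin t → ℕ) λ f → ∀ l → Q l (f l))
¬¬-finiteChoice {t = zero}  Q h = ¬¬-return ((λ ()) , λ ())
¬¬-finiteChoice {t = suc t} Q h =
  h zero ¬¬>>= λ (k , qk) →
  ¬¬-finiteChoice (Q ∘ suc) (h ∘ suc) ¬¬>>= λ (f , qf) →
  ¬¬-return (k ∷ f , λ { zero → qk ; (suc l) → qf l })

¬¬-maximum-below : (P : ℕ → Set p) → P 0 → ∀ b
                 → DoubleNegation (Σ ℕ λ k → P k × (∀ k′ → P k′ → k′ ≤ b → k′ ≤ k))
¬¬-maximum-below P p0 zero = ¬¬-return (0 , p0 , λ _ _ k′≤0 → k′≤0)
¬¬-maximum-below P p0 (suc b) =
  ¬¬-maximum-below P p0 b ¬¬>>= λ (k , pk , max) → ¬¬-excluded-middle ¬¬>>= λ where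
    (yes pb) → ¬¬-return (suc b , pb , λ _ _ k′≤1+b → k′≤1+b)
    (no ¬pb) → ¬¬-return (k , pk , λ k′ pk′ k′≤1+b →
      [ (λ k′<1+b → max k′ pk′ (ℕP.≤-pred k′<1+b)) , (λ { refl → contradiction pk′ ¬pb }) ]′
        (ℕP.m≤n⇒m<n∨m≡n k′≤1+b))

module _ {a r} {X : Set a} (_≈_ : X → X → Set r) where

  injection-surjection⇒≤ : (≈-sym : ∀ {x y} → x ≈ y → y ≈ x) (≈-trans : ∀ {x y z} → x ≈ y → y ≈ z → x ≈ z)
                         → ∀ {K L} (f : Fin K → X) (g : Fin L → X)
                         → (∀ i j → f i ≈ f j → i ≡ j) → (∀ x → ∃ λ l → g l ≈ x) → K ≤ L
  injection-surjection⇒≤ ≈-sym ≈-trans f g f-injective g-surjective = FinP.injective⇒≤ preimage-injective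
    where
    preimage : Fin _ → Fin _
    preimage i = proj₁ (g-surjective (f i))
    preimage-injective : ∀ {i j} → preimage i ≡ preimage j → i ≡ j
    preimage-injective {i} {j} eq = f-injective i j (≈-trans (≈-sym (proj₂ (g-surjective (f i))))
      (≡.subst (λ l → g l ≈ f j) (≡.sym eq) (proj₂ (g-surjective (f j)))))

  vectors : ∀ {L} → (Fin L → X) → ∀ k → Fin (L ^ k) → Fin k → X
  vectors     g zero    _ ()
  vectors {L} g (suc k) i = g (proj₁ (remQuot {L} (L ^ k) i)) ∷ vectors g k (proj₂ (remQuot {L} (L ^ k) i))

  vectors-injective : ∀ {L} (g : Fin L → X) → (∀ i j → g i ≈ g j → i ≡ j)
                    → ∀ k i j → (∀ p → vectors g k i p ≈ vectors g k j p) → i ≡ j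
  vectors-injective     g g-injective zero    zero zero _ = refl
  vectors-injective {L} g g-injective (suc k) i    j    h =
    Injection.injective (↔⇒↣ (FinP.*↔× {L} {L ^ k}))
      (×-≡,≡→≡ (g-injective _ _ (h zero) , vectors-injective g g-injective k _ _ (h ∘ suc)))

  vectors-surjective : ∀ {L} (g : Fin L → X) → (∀ x → ∃ λ i → g i ≈ x)
                     → ∀ k (v : Fin k → X) → ∃ λ i → ∀ p → vectors g k i p ≈ v p
  vectors-surjective     g g-surjective zero    v = zero , λ ()
  vectors-surjective {L} g g-surjective (suc k) v
    with g-surjective (v zero) | vectors-surjective g g-surjective k (v ∘ suc)
  ... | i₀ , g-i₀ | i , vectors-i =
    Fin.combine i₀ i , ≡.subst Hits (≡.sym (FinP.remQuot-combine {L} {L ^ k} i₀ i)) hits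
    where
    Hits : Fin L × Fin (L ^ k) → Set r
    Hits (j₀ , j) = ∀ p → (g j₀ ∷ vectors g k j) p ≈ v p
    hits : Hits (i₀ , i)
    hits zero    = g-i₀
    hits (suc p) = vectors-i p

∑ℕ-zero : ∀ k → ∑ℕ {k} (λ _ → 0) ≡ 0
∑ℕ-zero zero    = refl
∑ℕ-zero (suc k) = ∑ℕ-zero k

∑ℕ-mono-≤ : ∀ {k} {f g : Fin k → ℕ} → (∀ i → f i ≤ g i) → ∑ℕ f ≤ ∑ℕ g
∑ℕ-mono-≤ {zero}  f≤g = z≤n
∑ℕ-mono-≤ {suc k} f≤g = ℕP.+-mono-≤ (f≤g zero) (∑ℕ-mono-≤ (f≤g ∘ suc))

∑ℕ-distrib-+ : ∀ {k} (f g : Fin k → ℕ) → ∑ℕ (λ i → f i ℕ.+ g i) ≡ ∑ℕ f ℕ.+ ∑ℕ g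
∑ℕ-distrib-+ {zero}  f g = refl
∑ℕ-distrib-+ {suc k} f g = begin
  (f zero ℕ.+ g zero) ℕ.+ ∑ℕ (λ i → f (suc i) ℕ.+ g (suc i))
    ≡⟨ cong (f zero ℕ.+ g zero ℕ.+_) (∑ℕ-distrib-+ (f ∘ suc) (g ∘ suc)) ⟩
  (f zero ℕ.+ g zero) ℕ.+ (∑ℕ (f ∘ suc) ℕ.+ ∑ℕ (g ∘ suc))
    ≡⟨ +-interchange (f zero) (g zero) _ _ ⟩
  (f zero ℕ.+ ∑ℕ (f ∘ suc)) ℕ.+ (g zero ℕ.+ ∑ℕ (g ∘ suc))
    ∎
  where open ≡.≡-Reasoning

∑ℕ-ones : ∀ t → ∑ℕ {t} (λ _ → 1) ≡ t
∑ℕ-ones zero    = refl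
∑ℕ-ones (suc t) = cong suc (∑ℕ-ones t)

singletonExp-ones : ∀ t k → singletonExp {t} k (λ _ → 1) (λ _ → 1) ≡ t ∸ k
singletonExp-ones zero    zero    = refl
singletonExp-ones zero    (suc k) = refl
singletonExp-ones (suc t) zero    = cong suc (∑ℕ-ones t)
singletonExp-ones (suc t) (suc k) = singletonExp-ones t k

module RankBounds {c ℓ} (F : CommutativeRing c ℓ) (isField : IsField F) where
  open CommutativeRing F hiding (zero) renaming (Carrier to A; refl to ≈-refl)
  open import Relation.Binary.Reasoning.Setoid setoid
  open import Algebra.Properties.Ring ring using (-‿distribˡ-*; -0#≈0#)
  open import Algebra.Solver.Ring.NaturalCoefficients.Default commutativeSemiring
    using (solve; _:=_; _:+_; _:*_; con)

  1≉0 : 1# ≉ 0#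
  1≉0 1≈0 = proj₁ isField (sym 1≈0)

  *-cancelʳ-nonzero : ∀ {z x y} → z ≉ 0# → x * z ≈ y * z → x ≈ y
  *-cancelʳ-nonzero {z} {x} {y} z≉0 xz≈yz with proj₂ isField z z≉0
  ... | z⁻¹ , zz⁻¹≈1 = begin
    x              ≈⟨ sym (*-identityʳ x) ⟩
    x * 1#         ≈⟨ *-congˡ (sym zz⁻¹≈1) ⟩
    x * (z * z⁻¹)  ≈⟨ sym (*-assoc x z z⁻¹) ⟩
    (x * z) * z⁻¹  ≈⟨ *-congʳ xz≈yz ⟩
    (y * z) * z⁻¹  ≈⟨ *-assoc y z z⁻¹ ⟩
    y * (z * z⁻¹)  ≈⟨ *-congˡ zz⁻¹≈1 ⟩
    y * 1#         ≈⟨ *-identityʳ y ⟩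
    y              ∎

  *-nonzero : ∀ {x y} → x ≉ 0# → y ≉ 0# → x * y ≉ 0#
  *-nonzero {x} {y} x≉0 y≉0 xy≈0 = x≉0 (*-cancelʳ-nonzero y≉0 (trans xy≈0 (sym (zeroˡ y))))

  x*y+-y*x≈0 : ∀ x y → x * y + - y * x ≈ 0#
  x*y+-y*x≈0 x y = begin
    x * y + - y * x ≈⟨ solve 3 (λ x y -y → x :* y :+ -y :* x := x :* (y :+ -y)) ≈-refl x y (- y) ⟩
    x * (y - y)     ≈⟨ *-congˡ (-‿inverseʳ y) ⟩
    x * 0#          ≈⟨ zeroʳ x ⟩
    0#              ∎

  +≈+⇒-≈- : ∀ {a a′ u u′} → a + u ≈ a′ + u′ → a - a′ ≈ u′ - u
  +≈+⇒-≈- {a} {a′} {u} {u′} eq = begin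
    a - a′                   ≈⟨ sym (trans (+-congˡ (-‿inverseʳ u)) (+-identityʳ _)) ⟩
    (a - a′) + (u - u)       ≈⟨ swap-middle a (- a′) u (- u) ⟩
    (a + u) + (- a′ + - u)   ≈⟨ +-congʳ eq ⟩
    (a′ + u′) + (- a′ + - u) ≈⟨ swap-middle a′ u′ (- a′) (- u) ⟩
    (a′ - a′) + (u′ - u)     ≈⟨ trans (+-congʳ (-‿inverseʳ a′)) (+-identityˡ _) ⟩
    u′ - u                   ∎
    where
    swap-middle : ∀ w x y z → (w + x) + (y + z) ≈ (w + y) + (x + z)
    swap-middle = solve 4 (λ w x y z → (w :+ x) :+ (y :+ z) := (w :+ y) :+ (x :+ z)) ≈-refl

  Dependent₂ : A → A → Set (c ⊔ ℓ)
  Dependent₂ a₀ a₁ = Σ A λ x → Σ A λ y → (x ≉ 0# ⊎ y ≉ 0#) × x * a₀ + y * a₁ ≈ 0#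

  dependent₂ : ∀ a₀ a₁ → DoubleNegation (Dependent₂ a₀ a₁)
  dependent₂ a₀ a₁ = ¬¬-excluded-middle ¬¬>>= λ where
    (yes a₁≈0) → ¬¬-return (0# , 1# , inj₂ 1≉0 ,
      trans (+-cong (zeroˡ a₀) (trans (*-identityˡ a₁) a₁≈0)) (+-identityʳ 0#))
    (no a₁≉0) → ¬¬-return (a₁ , - a₀ , inj₁ a₁≉0 , x*y+-y*x≈0 a₁ a₀)

  Dependent₃ : (a₀ a₁ a₂ b₀ b₁ b₂ : A) → Set (c ⊔ ℓ)
  Dependent₃ a₀ a₁ a₂ b₀ b₁ b₂ = Σ A λ x → Σ A λ y → Σ A λ z →
    (x ≉ 0# ⊎ y ≉ 0# ⊎ z ≉ 0#) × x * a₀ + (y * a₁ + z * a₂) ≈ 0# × x * b₀ + (y * b₁ + z * b₂) ≈ 0#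

  dependent₃-swap : ∀ {a₀ a₁ a₂ b₀ b₁ b₂}
                  → Dependent₃ a₀ a₁ a₂ b₀ b₁ b₂ → Dependent₃ b₀ b₁ b₂ a₀ a₁ a₂
  dependent₃-swap (x , y , z , nt , ea , eb) = x , y , z , nt , eb , ea

  -- Gaussian elimination of the third coordinate against the pivot b₂.
  dependent₃-pivot : ∀ a₀ a₁ a₂ b₀ b₁ b₂ → b₂ ≉ 0# → DoubleNegation (Dependent₃ a₀ a₁ a₂ b₀ b₁ b₂)
  dependent₃-pivot a₀ a₁ a₂ b₀ b₁ b₂ b₂≉0 =
    dependent₂ (b₂ * a₀ + - b₀ * a₂) (b₂ * a₁ + - b₁ * a₂) ¬¬>>= λ (g₀ , g₁ , nt , eq) →
    ¬¬-return (g₀ * b₂ , g₁ * b₂ , g₀ * - b₀ + g₁ * - b₁ ,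
               scaled nt , trans (eliminated-a g₀ g₁) eq , eliminated-b g₀ g₁)
    where
    scaled : ∀ {g₀ g₁} → g₀ ≉ 0# ⊎ g₁ ≉ 0#
           → g₀ * b₂ ≉ 0# ⊎ g₁ * b₂ ≉ 0# ⊎ g₀ * - b₀ + g₁ * - b₁ ≉ 0#
    scaled (inj₁ g₀≉0) = inj₁ (*-nonzero g₀≉0 b₂≉0)
    scaled (inj₂ g₁≉0) = inj₂ (inj₁ (*-nonzero g₁≉0 b₂≉0))
    eliminated-a : ∀ g₀ g₁ → g₀ * b₂ * a₀ + (g₁ * b₂ * a₁ + (g₀ * - b₀ + g₁ * - b₁) * a₂)
                           ≈ g₀ * (b₂ * a₀ + - b₀ * a₂) + g₁ * (b₂ * a₁ + - b₁ * a₂)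
    eliminated-a g₀ g₁ = solve 8
      (λ g₀ g₁ a₀ a₁ a₂ b₂ -b₀ -b₁ →
         g₀ :* b₂ :* a₀ :+ (g₁ :* b₂ :* a₁ :+ (g₀ :* -b₀ :+ g₁ :* -b₁) :* a₂)
         := g₀ :* (b₂ :* a₀ :+ -b₀ :* a₂) :+ g₁ :* (b₂ :* a₁ :+ -b₁ :* a₂))
      ≈-refl g₀ g₁ a₀ a₁ a₂ b₂ (- b₀) (- b₁)
    eliminated-b : ∀ g₀ g₁ → g₀ * b₂ * b₀ + (g₁ * b₂ * b₁ + (g₀ * - b₀ + g₁ * - b₁) * b₂) ≈ 0#
    eliminated-b g₀ g₁ = begin
      g₀ * b₂ * b₀ + (g₁ * b₂ * b₁ + (g₀ * - b₀ + g₁ * - b₁) * b₂)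
        ≈⟨ solve 7 (λ g₀ g₁ b₀ b₁ b₂ -b₀ -b₁ →
                      g₀ :* b₂ :* b₀ :+ (g₁ :* b₂ :* b₁ :+ (g₀ :* -b₀ :+ g₁ :* -b₁) :* b₂)
                      := g₀ :* b₂ :* (b₀ :+ -b₀) :+ g₁ :* b₂ :* (b₁ :+ -b₁))
                   ≈-refl g₀ g₁ b₀ b₁ b₂ (- b₀) (- b₁) ⟩
      g₀ * b₂ * (b₀ - b₀) + g₁ * b₂ * (b₁ - b₁)
        ≈⟨ +-cong (*-congˡ (-‿inverseʳ b₀)) (*-congˡ (-‿inverseʳ b₁)) ⟩
      g₀ * b₂ * 0# + g₁ * b₂ * 0#
        ≈⟨ trans (+-cong (zeroʳ _) (zeroʳ _)) (+-identityʳ 0#) ⟩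
      0# ∎

  dependent₃ : ∀ a₀ a₁ a₂ b₀ b₁ b₂ → DoubleNegation (Dependent₃ a₀ a₁ a₂ b₀ b₁ b₂)
  dependent₃ a₀ a₁ a₂ b₀ b₁ b₂ = ¬¬-excluded-middle ¬¬>>= λ where
      (no b₂≉0) → dependent₃-pivot a₀ a₁ a₂ b₀ b₁ b₂ b₂≉0
      (yes b₂≈0) → ¬¬-excluded-middle ¬¬>>= λ where
        (no a₂≉0) → ¬¬-map dependent₃-swap (dependent₃-pivot b₀ b₁ b₂ a₀ a₁ a₂ a₂≉0)
        (yes a₂≈0) → ¬¬-return (0# , 0# , 1# , inj₂ (inj₂ 1≉0) , third a₂≈0 , third b₂≈0)
    where
    third : ∀ {u₀ u₁ u₂} → u₂ ≈ 0# → 0# * u₀ + (0# * u₁ + 1# * u₂) ≈ 0#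
    third {u₀} {u₁} u₂≈0 =
      trans (+-cong (zeroˡ u₀) (trans (+-cong (zeroˡ u₁) (trans (*-identityˡ _) u₂≈0)) (+-identityʳ 0#)))
            (+-identityʳ 0#)

  ∑-0* : ∀ {k} (f : Fin k → A) → ∑ F (λ i → 0# * f i) ≈ 0#
  ∑-0* {zero}  f = ≈-refl
  ∑-0* {suc k} f = trans (+-cong (zeroˡ (f zero)) (∑-0* (f ∘ suc))) (+-identityʳ 0#)

  indepRows≤rows : ∀ {r s k} (X : Matrix F r s) → HasIndepRows F X k → k ≤ r
  indepRows≤rows X (σ , σ-injective , _) = FinP.injective⇒≤ λ {i} {j} → σ-injective i j

  indepRows-zero : ∀ {r s k} (X : Matrix F r s) → (∀ i j → X i j ≈ 0#) → HasIndepRows F X k → k ≤ 0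
  indepRows-zero {k = zero}  X X≈0 _ = z≤n
  indepRows-zero {k = suc k} X X≈0 (σ , _ , indep) = contradiction (indep (1# ∷ λ _ → 0#) kills zero) 1≉0
    where
    kills : ∀ j → 1# * X (σ zero) j + ∑ F (λ i → 0# * X (σ (suc i)) j) ≈ 0#
    kills j = trans (+-cong (trans (*-congˡ (X≈0 _ j)) (zeroʳ 1#)) (∑-0* λ i → X (σ (suc i)) j)) (+-identityʳ 0#)

  indepRows-outer : ∀ {r s k} (X : Matrix F r s) (α : Fin r → A) (w : Fin s → A)
                  → (∀ i j → X i j ≈ α i * w j) → HasIndepRows F X k → k ≤ 1
  indepRows-outer {k = zero}        _ _ _ _ _ = z≤n
  indepRows-outer {k = suc zero}    _ _ _ _ _ = s≤s z≤n
  indepRows-outer {k = suc (suc k)} X α w X≈αw (σ , _ , indep) =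
    ⊥-elim $ dependent₂ (α (σ zero)) (α (σ (suc zero))) λ where
      (x , y , inj₁ x≉0 , dep) → x≉0 (indep (x ∷ y ∷ λ _ → 0#) (kills dep) zero)
      (x , y , inj₂ y≉0 , dep) → y≉0 (indep (x ∷ y ∷ λ _ → 0#) (kills dep) (suc zero))
    where
    kills : ∀ {x y} → x * α (σ zero) + y * α (σ (suc zero)) ≈ 0# → ∀ j
          → x * X (σ zero) j + (y * X (σ (suc zero)) j + ∑ F (λ i → 0# * X (σ (suc (suc i))) j)) ≈ 0#
    kills {x} {y} dep j = begin
      x * X (σ zero) j + (y * X (σ (suc zero)) j + ∑ F (λ i → 0# * X (σ (suc (suc i))) j))
        ≈⟨ +-cong (*-congˡ (X≈αw _ j)) (+-cong (*-congˡ (X≈αw _ j)) (∑-0* λ i → X (σ (suc (suc i))) j)) ⟩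
      x * (α₀ * w j) + (y * (α₁ * w j) + 0#)
        ≈⟨ solve 5 (λ x y α₀ α₁ wj → x :* (α₀ :* wj) :+ (y :* (α₁ :* wj) :+ con 0)
                                    := (x :* α₀ :+ y :* α₁) :* wj) ≈-refl x y α₀ α₁ (w j) ⟩
      (x * α₀ + y * α₁) * w j ≈⟨ *-congʳ dep ⟩
      0# * w j                ≈⟨ zeroˡ (w j) ⟩
      0#                      ∎
      where
      α₀ = α (σ zero)
      α₁ = α (σ (suc zero))

  indepRows-outer₂ : ∀ {r s k} (X : Matrix F r s) (α β : Fin r → A) (v w : Fin s → A)
                   → (∀ i j → X i j ≈ α i * v j + β i * w j) → HasIndepRows F X k → k ≤ 2
  indepRows-outer₂ {k = zero}              _ _ _ _ _ _ _ = z≤n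
  indepRows-outer₂ {k = suc zero}          _ _ _ _ _ _ _ = s≤s z≤n
  indepRows-outer₂ {k = suc (suc zero)}    _ _ _ _ _ _ _ = s≤s (s≤s z≤n)
  indepRows-outer₂ {k = suc (suc (suc k))} X α β v w X≈αv+βw (σ , _ , indep) =
    ⊥-elim $ dependent₃ (α i₀) (α i₁) (α i₂) (β i₀) (β i₁) (β i₂) λ where
      (x , y , z , inj₁ x≉0 , ea , eb)        → x≉0 (indep (x ∷ y ∷ z ∷ λ _ → 0#) (kills ea eb) zero)
      (x , y , z , inj₂ (inj₁ y≉0) , ea , eb) → y≉0 (indep (x ∷ y ∷ z ∷ λ _ → 0#) (kills ea eb) (suc zero))
      (x , y , z , inj₂ (inj₂ z≉0) , ea , eb) → z≉0 (indep (x ∷ y ∷ z ∷ λ _ → 0#) (kills ea eb) (suc (suc zero)))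
    where
    i₀ = σ zero
    i₁ = σ (suc zero)
    i₂ = σ (suc (suc zero))
    kills : ∀ {x y z} → x * α i₀ + (y * α i₁ + z * α i₂) ≈ 0# → x * β i₀ + (y * β i₁ + z * β i₂) ≈ 0#
          → ∀ j
          → x * X i₀ j + (y * X i₁ j + (z * X i₂ j + ∑ F (λ i → 0# * X (σ (suc (suc (suc i)))) j))) ≈ 0#
    kills {x} {y} {z} ea eb j = begin
      x * X i₀ j + (y * X i₁ j + (z * X i₂ j + ∑ F (λ i → 0# * X (σ (suc (suc (suc i)))) j)))
        ≈⟨ +-cong (*-congˡ (X≈αv+βw i₀ j)) (+-cong (*-congˡ (X≈αv+βw i₁ j))
             (+-cong (*-congˡ (X≈αv+βw i₂ j)) (∑-0* λ i → X (σ (suc (suc (suc i)))) j))) ⟩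
      x * (α i₀ * v j + β i₀ * w j) + (y * (α i₁ * v j + β i₁ * w j) + (z * (α i₂ * v j + β i₂ * w j) + 0#))
        ≈⟨ solve 11 (λ x y z α₀ α₁ α₂ β₀ β₁ β₂ vj wj →
             x :* (α₀ :* vj :+ β₀ :* wj) :+ (y :* (α₁ :* vj :+ β₁ :* wj) :+ (z :* (α₂ :* vj :+ β₂ :* wj) :+ con 0))
             := (x :* α₀ :+ (y :* α₁ :+ z :* α₂)) :* vj :+ (x :* β₀ :+ (y :* β₁ :+ z :* β₂)) :* wj)
           ≈-refl x y z (α i₀) (α i₁) (α i₂) (β i₀) (β i₁) (β i₂) (v j) (w j) ⟩
      (x * α i₀ + (y * α i₁ + z * α i₂)) * v j + (x * β i₀ + (y * β i₁ + z * β i₂)) * w j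
        ≈⟨ +-cong (*-congʳ ea) (*-congʳ eb) ⟩
      0# * v j + 0# * w j
        ≈⟨ trans (+-cong (zeroˡ (v j)) (zeroˡ (w j))) (+-identityʳ 0#) ⟩
      0# ∎

  ¬¬-rank : ∀ {r s} (X : Matrix F r s) → DoubleNegation (Σ ℕ (HasRank F X))
  ¬¬-rank {r} X =
    ¬¬-maximum-below (HasIndepRows F X) ((λ ()) , (λ ()) , λ _ _ ()) r ¬¬>>= λ (k , indep , max) →
    ¬¬-return (k , indep , λ k′ indep′ → max k′ indep′ (indepRows≤rows X indep′))

  AtMostRankOne : ℕ → ℕ → Set c
  AtMostRankOne r s = Maybe ((Fin r → A) × (Fin s → A))

  ⟦_⟧ : ∀ {r s} → AtMostRankOne r s → Matrix F r s
  ⟦ just (u , w) ⟧ i j = u i * w j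
  ⟦ nothing ⟧      i j = 0#

  rankBound : ∀ {r s} → AtMostRankOne r s → ℕ
  rankBound (just _) = 1
  rankBound nothing  = 0

  ∑ℕ-rankBound-single : ∀ {t r s} (k : Fin t) (x : (Fin r → A) × (Fin s → A))
                      → ∑ℕ (λ l → rankBound (updateAt (λ _ → nothing) k (λ _ → just x) l)) ≡ 1
  ∑ℕ-rankBound-single {suc t} zero    x = cong suc (∑ℕ-zero t)
  ∑ℕ-rankBound-single         (suc k) x = ∑ℕ-rankBound-single k x

  indepRows-difference : ∀ {r s k} (o o′ : AtMostRankOne r s) (X : Matrix F r s)
                       → (∀ i j → X i j ≈ ⟦ o′ ⟧ i j - ⟦ o ⟧ i j)
                       → HasIndepRows F X k → k ≤ rankBound o ℕ.+ rankBound o′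
  indepRows-difference nothing nothing X X≈ =
    indepRows-zero X λ i j → trans (X≈ i j) (-‿inverseʳ 0#)
  indepRows-difference (just (u , w)) nothing X X≈ =
    indepRows-outer X (λ i → - u i) w λ i j → trans (X≈ i j) (trans (+-identityˡ _) (-‿distribˡ-* (u i) (w j)))
  indepRows-difference nothing (just (u′ , w′)) X X≈ =
    indepRows-outer X u′ w′ λ i j → trans (X≈ i j) (trans (+-congˡ -0#≈0#) (+-identityʳ _))
  indepRows-difference (just (u , w)) (just (u′ , w′)) X X≈ =
    indepRows-outer₂ X u′ (λ i → - u i) w′ w λ i j → trans (X≈ i j) (+-congˡ (-‿distribˡ-* (u i) (w j)))

-- (qᵏ − 1)/(q − 1), the number of nonzero vectors of 𝔽_q^k up to scaling.
projPoints : ℕ → ℕ → ℕ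
projPoints q zero    = 0
projPoints q (suc k) = q ^ k ℕ.+ projPoints q k

-- Here and below q = suc q′ and t = suc t′.
ballSize : (q′ n m t′ : ℕ) → ℕ
ballSize q′ n m t′ = suc (projPoints (suc q′) n ℕ.* (q′ ℕ.* projPoints (suc q′) m) ℕ.+ t′ ℕ.* q′)

fieldSize≥2 : ∀ {c ℓ} (F : CommutativeRing c ℓ) {q} → IsField F → HasSize F q → 2 ≤ q
fieldSize≥2 F {zero} _ (_ , _ , surjective) with surjective (CommutativeRing.0# F)
... | () , _
fieldSize≥2 F {suc zero} (0≉1 , _) (_ , _ , surjective)
  with surjective (CommutativeRing.0# F) | surjective (CommutativeRing.1# F)
... | zero , e≈0 | zero , e≈1 = ⊥-elim (0≉1 (CommutativeRing.trans F (CommutativeRing.sym F e≈0) e≈1))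
fieldSize≥2 F {suc (suc q″)} _ _ = s≤s (s≤s z≤n)

module FiniteField {c ℓ} (F : CommutativeRing c ℓ) (isField : IsField F) {q′ : ℕ} (hasSize : HasSize F (suc q′)) where
  open CommutativeRing F hiding (zero) renaming (Carrier to A; refl to ≈-refl)
  open RankBounds F isField

  q : ℕ
  q = suc q′

  element : Fin q → A
  element = proj₁ hasSize

  element-injective : ∀ i j → element i ≈ element j → i ≡ j
  element-injective = proj₁ (proj₂ hasSize)

  element-surjective : ∀ x → ∃ λ i → element i ≈ x
  element-surjective = proj₂ (proj₂ hasSize)

  _≋_ : ∀ {k} → (Fin k → A) → (Fin k → A) → Set ℓ
  v ≋ w = ∀ p → v p ≈ w p

  NonZeroVec : ∀ {k} → (Fin k → A) → Set ℓ
  NonZeroVec w = ∃ λ j → w j ≉ 0#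

  nonzero : Fin q′ → A
  nonzero = element ∘ Fin.punchIn (proj₁ (element-surjective 0#))

  nonzero-≉0 : ∀ a → nonzero a ≉ 0#
  nonzero-≉0 a a≈0 = FinP.punchInᵢ≢i _ a (element-injective _ _ (trans a≈0 (sym (proj₂ (element-surjective 0#)))))

  nonzero-injective : ∀ a b → nonzero a ≈ nonzero b → a ≡ b
  nonzero-injective a b eq = FinP.punchIn-injective _ a b (element-injective _ _ eq)

  allVectors : ∀ k → Fin (q ^ k) → Fin k → A
  allVectors = vectors _≈_ element

  allVectors-surjective : ∀ k (v : Fin k → A) → ∃ λ i → allVectors k i ≋ v
  allVectors-surjective = vectors-surjective _≈_ element element-surjective

  -- The first nonzero coordinate of a normalised vector is 1: either the head is 1 and the
  -- tail is arbitrary, or the head is 0 and the tail is normalised.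
  normalised : ∀ k → Fin (projPoints q k) → Fin k → A
  normalised-by-head : ∀ k → Fin (q ^ k) ⊎ Fin (projPoints q k) → Fin (suc k) → A
  normalised (suc k) i = normalised-by-head k (Fin.splitAt (q ^ k) i)
  normalised-by-head k (inj₁ x) = 1# ∷ allVectors k x
  normalised-by-head k (inj₂ y) = 0# ∷ normalised k y

  normalised-hasOne : ∀ k i → ∃ λ p → normalised k i p ≈ 1#
  normalised-by-head-hasOne : ∀ k x → ∃ λ p → normalised-by-head k x p ≈ 1#
  normalised-hasOne (suc k) i = normalised-by-head-hasOne k (Fin.splitAt (q ^ k) i)
  normalised-by-head-hasOne k (inj₁ x) = zero , ≈-refl
  normalised-by-head-hasOne k (inj₂ y) with normalised-hasOne k y
  ... | p , one = suc p , one

  outer-injective : ∀ k {s} (i i′ : Fin (projPoints q k)) (w w′ : Fin s → A) → NonZeroVec w → NonZeroVec w′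
                  → (∀ r j → normalised k i r * w j ≈ normalised k i′ r * w′ j) → i ≡ i′ × w ≋ w′
  outer-by-head-injective : ∀ k {s} (x x′ : Fin (q ^ k) ⊎ Fin (projPoints q k)) (w w′ : Fin s → A)
                  → NonZeroVec w → NonZeroVec w′
                  → (∀ r j → normalised-by-head k x r * w j ≈ normalised-by-head k x′ r * w′ j) → x ≡ x′ × w ≋ w′
  outer-injective (suc k) i i′ w w′ w≠0 w′≠0 eq
    with outer-by-head-injective k (Fin.splitAt (q ^ k) i) (Fin.splitAt (q ^ k) i′) w w′ w≠0 w′≠0 eq
  ... | splitAt-eq , w≋w′ = Injection.injective (↔⇒↣ (FinP.+↔⊎ {q ^ k})) splitAt-eq , w≋w′
  outer-by-head-injective k (inj₁ x) (inj₁ x′) w w′ (j₀ , wj₀≉0) _ eq =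
    cong inj₁ (vectors-injective _≈_ element element-injective k x x′ tails) , w≋w′
    where
    w≋w′ : w ≋ w′
    w≋w′ j = trans (sym (*-identityˡ (w j))) (trans (eq zero j) (*-identityˡ (w′ j)))
    tails : allVectors k x ≋ allVectors k x′
    tails r = *-cancelʳ-nonzero wj₀≉0 (trans (eq (suc r) j₀) (*-congˡ (sym (w≋w′ j₀))))
  outer-by-head-injective k (inj₁ x) (inj₂ y′) w w′ (j₀ , wj₀≉0) _ eq =
    contradiction (trans (sym (*-identityˡ (w j₀))) (trans (eq zero j₀) (zeroˡ (w′ j₀)))) wj₀≉0
  outer-by-head-injective k (inj₂ y) (inj₁ x′) w w′ _ (j₀ , w′j₀≉0) eq =
    contradiction (trans (sym (*-identityˡ (w′ j₀))) (trans (sym (eq zero j₀)) (zeroˡ (w j₀)))) w′j₀≉0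
  outer-by-head-injective k (inj₂ y) (inj₂ y′) w w′ w≠0 w′≠0 eq
    with outer-injective k y y′ w w′ w≠0 w′≠0 (eq ∘ suc)
  ... | refl , w≋w′ = refl , w≋w′

module SpherePacking {c ℓ} (F : CommutativeRing c ℓ) (isField : IsField F) {q′ : ℕ} (hasSize : HasSize F (suc q′))
                     (n m t′ : ℕ) (C : Code F {suc t′} (firstThen1 n) (firstThen1 m) 3) where
  open CommutativeRing F hiding (zero) renaming (Carrier to A; refl to ≈-refl)
  open import Algebra.Properties.Ring ring using (+-cancelˡ)
  open RankBounds F isField
  open FiniteField F isField hasSize
  open Code C

  -- The points of a ball of radius 1 other than its centre: rankOne u a v is the matrix u (a · v)ᵀ in
  -- the n × m block (u, v normalised, a ≠ 0), and unit k a is the scalar a ≠ 0 in the 1 × 1 block k.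
  Perturbation : Set
  Perturbation = ⊤ ⊎ (Fin (projPoints q n) × Fin q′ × Fin (projPoints q m)) ⊎ (Fin t′ × Fin q′)

  pattern none          = inj₁ tt
  pattern rankOne u a v = inj₂ (inj₁ (u , a , v))
  pattern unit k a      = inj₂ (inj₂ (k , a))

  perturbationIndex : Fin (ballSize q′ n m t′) ↔ Perturbation
  perturbationIndex =
    ↔-trans FinP.+↔⊎
      (FinP.1↔⊤ ⊎-↔ ↔-trans FinP.+↔⊎ (↔-trans FinP.*↔× (↔-refl ×-↔ FinP.*↔×) ⊎-↔ FinP.*↔×))

  rankOneFactor : Fin q′ → Fin (projPoints q m) → Fin m → A
  rankOneFactor a v j = normalised m v j * nonzero a

  components : Perturbation → (l : Fin (suc t′)) → AtMostRankOne (firstThen1 n l) (firstThen1 m l)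
  components none            _       = nothing
  components (rankOne u a v) zero    = just (normalised n u , rankOneFactor a v)
  components (rankOne _ _ _) (suc _) = nothing
  components (unit _ _)      zero    = nothing
  components (unit k a)      (suc l) = updateAt (λ _ → nothing) k (λ _ → just ((λ _ → nonzero a) , λ _ → 1#)) l

  rankBound-components : ∀ π → ∑ℕ (λ l → rankBound (components π l)) ≤ 1
  rankBound-components none            = ℕP.≤-trans (ℕP.≤-reflexive (∑ℕ-zero t′)) z≤n
  rankBound-components (rankOne _ _ _) = ℕP.≤-reflexive (cong suc (∑ℕ-zero t′))
  rankBound-components (unit k a)      = ℕP.≤-reflexive (∑ℕ-rankBound-single k _)

  unit-value : ∀ k a → ⟦ components (unit k a) (suc k) ⟧ zero zero ≈ nonzero a
  unit-value k a = trans (reflexive (cong (λ o → ⟦ o ⟧ zero zero) (updateAt-updates k (λ _ → nothing))))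
                         (*-identityʳ (nonzero a))

  unit-nonzero : ∀ k a → ⟦ components (unit k a) (suc k) ⟧ zero zero ≉ 0#
  unit-nonzero k a u≈0 = nonzero-≉0 a (trans (sym (unit-value k a)) u≈0)

  rankOneFactor-nonzero : ∀ a v → NonZeroVec (rankOneFactor a v)
  rankOneFactor-nonzero a v with normalised-hasOne m v
  ... | p , one = p , λ w≈0 → nonzero-≉0 a (trans (sym (trans (*-congʳ one) (*-identityˡ _))) w≈0)

  rankOne-nonzero : ∀ u a v → ¬ (∀ r j → ⟦ components (rankOne u a v) zero ⟧ r j ≈ 0#)
  rankOne-nonzero u a v vanishes with normalised-hasOne n u | rankOneFactor-nonzero a v
  ... | r , one | j , w≉0 = *-nonzero (λ u≈0 → 1≉0 (trans (sym one) u≈0)) w≉0 (vanishes r j)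

  perturbation-injective : ∀ π π′ → (∀ l r j → ⟦ components π l ⟧ r j ≈ ⟦ components π′ l ⟧ r j)
                         → π ≡ π′
  perturbation-injective none            none              _  = refl
  perturbation-injective none            (rankOne u a v)   eq = ⊥-elim (rankOne-nonzero u a v λ r j → sym (eq zero r j))
  perturbation-injective (unit _ _)      (rankOne u a v)   eq = ⊥-elim (rankOne-nonzero u a v λ r j → sym (eq zero r j))
  perturbation-injective (rankOne u a v) none              eq = ⊥-elim (rankOne-nonzero u a v (eq zero))
  perturbation-injective (rankOne u a v) (unit _ _)        eq = ⊥-elim (rankOne-nonzero u a v (eq zero))
  perturbation-injective none            (unit k a)        eq = ⊥-elim (unit-nonzero k a (sym (eq (suc k) zero zero)))
  perturbation-injective (unit k a)      none              eq = ⊥-elim (unit-nonzero k a (eq (suc k) zero zero))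
  perturbation-injective (rankOne u a v) (rankOne u′ a′ v′) eq
    with outer-injective n u u′ (rankOneFactor a v) (rankOneFactor a′ v′)
           (rankOneFactor-nonzero a v) (rankOneFactor-nonzero a′ v′) (eq zero)
  ... | refl , factors-eq
    with outer-injective m {1} v v′ (λ _ → nonzero a) (λ _ → nonzero a′)
           (zero , nonzero-≉0 a) (zero , nonzero-≉0 a′) (λ j _ → factors-eq j)
  ... | refl , scalars-eq with nonzero-injective a a′ (scalars-eq zero)
  ... | refl = refl
  perturbation-injective (unit k a) (unit k′ a′) eq with k Fin.≟ k′
  ... | yes refl = cong (λ b → unit k b) (nonzero-injective a a′
                     (trans (sym (unit-value k a)) (trans (eq (suc k) zero zero) (unit-value k a′))))
  ... | no k≢k′ = ⊥-elim (unit-nonzero k a (trans (eq (suc k) zero zero)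
                    (reflexive (cong (λ o → ⟦ o ⟧ zero zero) (updateAt-minimal k k′ (λ _ → nothing) k≢k′)))))

  Space : Set c
  Space = Mat F {suc t′} (firstThen1 n) (firstThen1 m)

  _≈ˢ_ : Space → Space → Set ℓ
  _≈ˢ_ = _≈ᴹ_ F {N = firstThen1 n} {firstThen1 m}

  ballPoint : Fin size → Perturbation → Space
  ballPoint i π l r j = word i l r j + ⟦ components π l ⟧ r j

  -- Ranks exist only classically; the double negation is eliminated because i ≡ i′ is decidable.
  balls-disjoint : ∀ i i′ π π′ → ballPoint i π ≈ˢ ballPoint i′ π′ → i ≡ i′
  balls-disjoint i i′ π π′ eq = decidable-stable (i Fin.≟ i′) λ i≢i′ →
    ¬¬-finiteChoice (λ l → HasRank F (D l)) (λ l → ¬¬-rank (D l)) λ (rk , rk-ranks) →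
      ℕP.≤⇒≯ (sumRank≤2 rk (proj₁ ∘ rk-ranks)) (distLower i i′ i≢i′ (∑ℕ rk) (rk , rk-ranks , refl))
    where
    D : Space
    D = _-ᴹ_ F {N = firstThen1 n} {firstThen1 m} (word i) (word i′)
    terms : Perturbation → Fin (suc t′) → ℕ
    terms π l = rankBound (components π l)
    sumRank≤2 : (rk : Fin (suc t′) → ℕ) → (∀ l → HasIndepRows F (D l) (rk l)) → ∑ℕ rk ≤ 2
    sumRank≤2 rk indep = begin
      ∑ℕ rk
        ≤⟨ ∑ℕ-mono-≤ (λ l → indepRows-difference (components π l) (components π′ l) (D l)
                              (λ r j → +≈+⇒-≈- (eq l r j)) (indep l)) ⟩
      ∑ℕ (λ l → terms π l ℕ.+ terms π′ l)
        ≡⟨ ∑ℕ-distrib-+ (terms π) (terms π′) ⟩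
      ∑ℕ (terms π) ℕ.+ ∑ℕ (terms π′)
        ≤⟨ ℕP.+-mono-≤ (rankBound-components π) (rankBound-components π′) ⟩
      2 ∎
      where open ℕP.≤-Reasoning

  ball-injective : ∀ i π π′ → ballPoint i π ≈ˢ ballPoint i π′ → π ≡ π′
  ball-injective i π π′ eq = perturbation-injective π π′ λ l r j → +-cancelˡ (word i l r j) _ _ (eq l r j)

  ballPointOf : Fin size × Fin (ballSize q′ n m t′) → Space
  ballPointOf (i , β) = ballPoint i (Inverse.to perturbationIndex β)

  ballPointOf-injective : ∀ x x′ → ballPointOf x ≈ˢ ballPointOf x′ → x ≡ x′
  ballPointOf-injective (i , β) (i′ , β′) eq
    with balls-disjoint i i′ (Inverse.to perturbationIndex β) (Inverse.to perturbationIndex β′) eq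
  ... | refl = cong (i ,_) (Injection.injective (↔⇒↣ perturbationIndex)
                 (ball-injective i (Inverse.to perturbationIndex β) (Inverse.to perturbationIndex β′) eq))

  ballPoints : Fin (size ℕ.* ballSize q′ n m t′) → Space
  ballPoints = ballPointOf ∘ remQuot {size} (ballSize q′ n m t′)

  ballPoints-injective : ∀ ι ι′ → ballPoints ι ≈ˢ ballPoints ι′ → ι ≡ ι′
  ballPoints-injective ι ι′ eq = Injection.injective (↔⇒↣ (FinP.*↔× {size})) (ballPointOf-injective _ _ eq)

  spaceOf : Fin ((q ^ m) ^ n) × Fin (q ^ t′) → Space
  spaceOf (x , y) zero    = vectors (_≋_ {m}) (allVectors m) n x
  spaceOf (x , y) (suc l) = λ _ _ → allVectors t′ y l

  allSpace : Fin ((q ^ m) ^ n ℕ.* q ^ t′) → Space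
  allSpace = spaceOf ∘ remQuot {(q ^ m) ^ n} (q ^ t′)

  allSpace-surjective : ∀ X → ∃ λ ι → allSpace ι ≈ˢ X
  allSpace-surjective X
    with vectors-surjective _≋_ (allVectors m) (allVectors-surjective m) n (X zero)
       | allVectors-surjective t′ (λ l → X (suc l) zero zero)
  ... | x , x-covers | y , y-covers =
    Fin.combine x y , ≡.subst (λ z → spaceOf z ≈ˢ X) (≡.sym (FinP.remQuot-combine x y)) covers
    where
    covers : spaceOf (x , y) ≈ˢ X
    covers zero    r    j    = x-covers r j
    covers (suc l) zero zero = y-covers l

  sphere-packing : size ℕ.* ballSize q′ n m t′ ≤ (q ^ m) ^ n ℕ.* q ^ t′
  sphere-packing =
    injection-surjection⇒≤ _≈ˢ_ (λ eq l r j → sym (eq l r j)) (λ eq eq′ l r j → trans (eq l r j) (eq′ l r j))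
                           ballPoints allSpace ballPoints-injective allSpace-surjective

suc[q′*projPoints]≡q^ : ∀ q′ k → suc (q′ ℕ.* projPoints (suc q′) k) ≡ suc q′ ^ k
suc[q′*projPoints]≡q^ q′ zero    = cong suc (ℕP.*-zeroʳ q′)
suc[q′*projPoints]≡q^ q′ (suc k) = begin
  suc (q′ ℕ.* (q ^ k ℕ.+ projPoints q k))      ≡⟨ distribute q′ (q ^ k) (projPoints q k) ⟩
  q′ ℕ.* q ^ k ℕ.+ suc (q′ ℕ.* projPoints q k) ≡⟨ cong (q′ ℕ.* q ^ k ℕ.+_) (suc[q′*projPoints]≡q^ q′ k) ⟩
  q′ ℕ.* q ^ k ℕ.+ q ^ k                       ≡⟨ ℕP.+-comm (q′ ℕ.* q ^ k) (q ^ k) ⟩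
  q ^ suc k                                    ∎
  where
  open ≡.≡-Reasoning
  q = suc q′
  distribute : ∀ a b c → suc (a ℕ.* (b ℕ.+ c)) ≡ a ℕ.* b ℕ.+ suc (a ℕ.* c)
  distribute = solve-∀

pos-^ : ∀ a k → (+ a) ℤ.^ k ≡ + (a ^ k)
pos-^ a zero    = refl
pos-^ a (suc k) = ≡.trans (cong (+ a ℤ.*_) (pos-^ a k)) (≡.sym (ℤP.pos-* a (a ^ k)))

+≤+-∸ : ∀ {l p n} → l ℕ.+ n ≤ p → + l ℤ.≤ + p ℤ.- + n
+≤+-∸ {l} {p} {n} l+n≤p
  rewrite ℤP.[+m]-[+n]≡m⊖n p n | ℤP.⊖-≥ (ℕP.m+n≤o⇒n≤o l l+n≤p) = ℤ.+≤+ (ℕP.m+n≤o⇒m≤o∸n l l+n≤p)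

cancel-power : ∀ q′ e {b c} → suc q′ ^ e ℕ.* b ≤ suc q′ ^ e ℕ.* c → b ≤ c
cancel-power q′ e = ℕP.*-cancelˡ-≤ (suc q′ ^ e) {{ℕP.m^n≢0 (suc q′) e}}

^-double : ∀ a m → a ^ (2 ℕ.* m) ≡ a ^ m ℕ.* a ^ m
^-double a m = ≡.trans (ℕP.^-distribˡ-+-* a m (m ℕ.+ 0)) (cong (λ k → a ^ m ℕ.* a ^ k) (ℕP.+-identityʳ m))

^-double-suc : ∀ a m → a ^ (2 ℕ.* m ℕ.+ 1) ≡ a ^ m ℕ.* a ^ m ℕ.* a
^-double-suc a m = ≡.trans (ℕP.^-distribˡ-+-* a (2 ℕ.* m) 1) (cong₂ ℕ._*_ (^-double a m) (ℕP.*-identityʳ a))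

ballSize≤qP⇒t≤P : ∀ q′ .{{_ : NonZero q′}} Y t′ {P} → P ≡ suc Y
                → suc (1 ℕ.* Y ℕ.+ t′ ℕ.* q′) ≤ suc q′ ℕ.* P → t′ ≤ P
ballSize≤qP⇒t≤P q′ Y t′ refl B≤qP =
  ℕP.*-cancelʳ-≤ t′ (suc Y) q′ (ℕP.+-cancelˡ-≤ (suc Y) _ _ (subst₂ _≤_ (lhs Y t′ q′) (rhs Y q′) B≤qP))
  where
  lhs : ∀ Y t′ q′ → suc (1 ℕ.* Y ℕ.+ t′ ℕ.* q′) ≡ suc Y ℕ.+ t′ ℕ.* q′
  lhs = solve-∀
  rhs : ∀ Y q′ → suc q′ ℕ.* suc Y ≡ suc Y ℕ.+ suc Y ℕ.* q′
  rhs = solve-∀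

packing⇒bound₁ : ∀ q′ .{{_ : NonZero q′}} m t′
               → suc q′ ^ (t′ ∸ 1) ℕ.* ballSize q′ 1 m t′ ≤ (suc q′ ^ m) ^ 1 ℕ.* suc q′ ^ t′
               → + suc t′ ℤ.≤ + 1 ℤ.+ (+ suc q′) ℤ.^ m
packing⇒bound₁ q′ m zero     _       rewrite pos-^ (suc q′) m = ℤ.+≤+ (s≤s z≤n)
packing⇒bound₁ q′ m (suc t″) packing rewrite pos-^ (suc q′) m =
  ℤ.+≤+ (s≤s (ballSize≤qP⇒t≤P q′ (q′ ℕ.* projPoints q m) (suc t″) (≡.sym (suc[q′*projPoints]≡q^ q′ m))
                (cancel-power q′ t″ (ℕP.≤-trans packing (ℕP.≤-reflexive (rearrange (q ^ m) q (q ^ t″)))))))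
  where
  q = suc q′
  rearrange : ∀ P q Q → (P ℕ.* 1) ℕ.* (q ℕ.* Q) ≡ Q ℕ.* (q ℕ.* P)
  rearrange = solve-∀

ℤ-regroup₂ : ∀ a b c d e → a ℤ.- b ℤ.- c ℤ.+ d ℤ.- e ≡ (a ℤ.+ d) ℤ.- (b ℤ.+ c ℤ.+ e)
ℤ-regroup₂ = ℤSolver.solve-∀

ℕ-ineq⇒ℤ-bound₂ : ∀ {l a b c d} {L A B C D : ℤ}
         → L ≡ + l → A ≡ + a → B ≡ + b → C ≡ + c → D ≡ + d
         → l ℕ.+ (b ℕ.+ c ℕ.+ 1) ≤ a ℕ.+ d
         → L ℤ.≤ A ℤ.- B ℤ.- C ℤ.+ D ℤ.- + 1
ℕ-ineq⇒ℤ-bound₂ {l} {a} {b} {c} {d} refl refl refl refl refl ineq =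
  ≡.subst (+ l ℤ.≤_) (≡.sym (ℤ-regroup₂ (+ a) (+ b) (+ c) (+ d) (+ 1))) (+≤+-∸ ineq)

-- suc q′ * 1 + 1 is projPoints (suc q′) 2 unfolded, so that the ring solver can read the statement.
ballSize≤P²⇒ineq₂ : ∀ q′ Y t′ {P} → P ≡ suc Y
            → suc ((suc q′ ℕ.* 1 ℕ.+ 1) ℕ.* Y ℕ.+ t′ ℕ.* q′) ≤ P ℕ.* P
            → suc t′ ℕ.* q′ ℕ.+ (suc q′ ℕ.* P ℕ.+ P ℕ.+ 1) ≤ P ℕ.* P ℕ.+ 2 ℕ.* suc q′
ballSize≤P²⇒ineq₂ q′ Y t′ refl B≤P² = subst₂ _≤_ (lhs q′ Y t′) (rhs q′ Y) (ℕP.+-monoˡ-≤ _ B≤P²)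
  where
  lhs : ∀ q′ Y t′ → suc ((suc q′ ℕ.* 1 ℕ.+ 1) ℕ.* Y ℕ.+ t′ ℕ.* q′) ℕ.+ (q′ ℕ.+ suc q′ ℕ.+ 1)
                  ≡ suc t′ ℕ.* q′ ℕ.+ (suc q′ ℕ.* suc Y ℕ.+ suc Y ℕ.+ 1)
  lhs = solve-∀
  rhs : ∀ q′ Y → suc Y ℕ.* suc Y ℕ.+ (q′ ℕ.+ suc q′ ℕ.+ 1) ≡ suc Y ℕ.* suc Y ℕ.+ 2 ℕ.* suc q′
  rhs = solve-∀

packing⇒bound₂ : ∀ q′ m t′
            → suc q′ ^ t′ ℕ.* ballSize q′ 2 m t′ ≤ (suc q′ ^ m) ^ 2 ℕ.* suc q′ ^ t′
            → (+ suc t′) ℤ.* ((+ suc q′) ℤ.- (+ 1))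
                ℤ.≤ (+ suc q′) ℤ.^ (2 ℕ.* m) ℤ.- (+ suc q′) ℤ.^ (suc m) ℤ.- (+ suc q′) ℤ.^ m
                    ℤ.+ (+ 2) ℤ.* (+ suc q′) ℤ.- (+ 1)
packing⇒bound₂ q′ m t′ packing =
  ℕ-ineq⇒ℤ-bound₂ (≡.sym (ℤP.pos-* (suc t′) q′)) (pos-^ q (2 ℕ.* m)) (pos-^ q (suc m)) (pos-^ q m) refl ineq
  where
  q = suc q′
  rearrange : ∀ P Q → (P ℕ.* (P ℕ.* 1)) ℕ.* Q ≡ Q ℕ.* (P ℕ.* P)
  rearrange = solve-∀
  ineq : suc t′ ℕ.* q′ ℕ.+ (q ^ suc m ℕ.+ q ^ m ℕ.+ 1) ≤ q ^ (2 ℕ.* m) ℕ.+ 2 ℕ.* q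
  ineq rewrite ^-double q m =
    ballSize≤P²⇒ineq₂ q′ (q′ ℕ.* projPoints q m) t′ (≡.sym (suc[q′*projPoints]≡q^ q′ m))
      (cancel-power q′ t′ (ℕP.≤-trans packing (ℕP.≤-reflexive (rearrange (q ^ m) (q ^ t′)))))

ℤ-regroup₃ : ∀ a b c d e f g h
           → a ℤ.- b ℤ.- c ℤ.+ d ℤ.+ e ℤ.+ f ℤ.- g ℤ.+ h ≡ (a ℤ.+ d ℤ.+ e ℤ.+ f ℤ.+ h) ℤ.- (b ℤ.+ c ℤ.+ g)
ℤ-regroup₃ = ℤSolver.solve-∀

ℕ-ineq⇒ℤ-bound₃ : ∀ {l a b c d e f g} {L A B C D E F G : ℤ}
         → L ≡ + l → A ≡ + a → B ≡ + b → C ≡ + c → D ≡ + d → E ≡ + e → F ≡ + f → G ≡ + g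
         → l ℕ.+ (b ℕ.+ c ℕ.+ g) ≤ a ℕ.+ d ℕ.+ e ℕ.+ f ℕ.+ 1
         → L ℤ.≤ A ℤ.- B ℤ.- C ℤ.+ D ℤ.+ E ℤ.+ F ℤ.- G ℤ.+ + 1
ℕ-ineq⇒ℤ-bound₃ {l} {a} {b} {c} {d} {e} {f} {g} refl refl refl refl refl refl refl refl ineq =
  ≡.subst (+ l ℤ.≤_) (≡.sym (ℤ-regroup₃ (+ a) (+ b) (+ c) (+ d) (+ e) (+ f) (+ g) (+ 1))) (+≤+-∸ ineq)

ballSize≤P²⇒ineq₃ : ∀ q′ X N t′ {P R} → P ≡ suc (q′ ℕ.* X) → R ≡ suc (q′ ℕ.* N)
            → suc (N ℕ.* (q′ ℕ.* X) ℕ.+ t′ ℕ.* q′) ≤ P ℕ.* P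
            → suc t′ ℕ.* q′ ^ 2 ℕ.+ (P ℕ.* P ℕ.+ P ℕ.* R ℕ.+ 3 ℕ.* suc q′)
              ≤ P ℕ.* P ℕ.* suc q′ ℕ.+ P ℕ.+ R ℕ.+ suc q′ ^ 2 ℕ.+ 1
ballSize≤P²⇒ineq₃ q′ X N t′ refl refl B≤P² =
  subst₂ _≤_ (lhs q′ X N t′) (rhs q′ X N) (ℕP.+-monoˡ-≤ _ (ℕP.*-monoʳ-≤ q′ B≤P²))
  where
  lhs : ∀ q′ X N t′
      → q′ ℕ.* suc (N ℕ.* (q′ ℕ.* X) ℕ.+ t′ ℕ.* q′)
          ℕ.+ (q′ ℕ.* (q′ ℕ.* 1) ℕ.+ 2 ℕ.* q′ ℕ.+ 4 ℕ.+ suc (q′ ℕ.* X) ℕ.* suc (q′ ℕ.* X) ℕ.+ q′ ℕ.* X ℕ.+ q′ ℕ.* N)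
        ≡ suc t′ ℕ.* (q′ ℕ.* (q′ ℕ.* 1))
          ℕ.+ (suc (q′ ℕ.* X) ℕ.* suc (q′ ℕ.* X) ℕ.+ suc (q′ ℕ.* X) ℕ.* suc (q′ ℕ.* N) ℕ.+ 3 ℕ.* suc q′)
  lhs = solve-∀
  rhs : ∀ q′ X N
      → q′ ℕ.* (suc (q′ ℕ.* X) ℕ.* suc (q′ ℕ.* X))
          ℕ.+ (q′ ℕ.* (q′ ℕ.* 1) ℕ.+ 2 ℕ.* q′ ℕ.+ 4 ℕ.+ suc (q′ ℕ.* X) ℕ.* suc (q′ ℕ.* X) ℕ.+ q′ ℕ.* X ℕ.+ q′ ℕ.* N)
        ≡ suc (q′ ℕ.* X) ℕ.* suc (q′ ℕ.* X) ℕ.* suc q′ ℕ.+ suc (q′ ℕ.* X) ℕ.+ suc (q′ ℕ.* N)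
          ℕ.+ suc q′ ℕ.* (suc q′ ℕ.* 1) ℕ.+ 1
  rhs = solve-∀

packing⇒bound₃ : ∀ q′ m n t′ → 2 ℕ.< n
            → suc q′ ^ ((m ℕ.* n ∸ m ℕ.* 2) ℕ.+ t′) ℕ.* ballSize q′ n m t′ ≤ (suc q′ ^ m) ^ n ℕ.* suc q′ ^ t′
            → (+ suc t′) ℤ.* (((+ suc q′) ℤ.- (+ 1)) ℤ.^ 2)
                ℤ.≤ (+ suc q′) ℤ.^ (2 ℕ.* m ℕ.+ 1) ℤ.- (+ suc q′) ℤ.^ (2 ℕ.* m)
                    ℤ.- (+ suc q′) ℤ.^ (m ℕ.+ n) ℤ.+ (+ suc q′) ℤ.^ m ℤ.+ (+ suc q′) ℤ.^ n
                    ℤ.+ (+ suc q′) ℤ.^ 2 ℤ.- (+ 3) ℤ.* (+ suc q′) ℤ.+ (+ 1)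
packing⇒bound₃ q′ m n t′ 2<n packing =
  ℕ-ineq⇒ℤ-bound₃ (≡.trans (cong (+ suc t′ ℤ.*_) (pos-^ q′ 2)) (≡.sym (ℤP.pos-* (suc t′) (q′ ^ 2))))
           (pos-^ q (2 ℕ.* m ℕ.+ 1)) (pos-^ q (2 ℕ.* m)) (pos-^ q (m ℕ.+ n)) (pos-^ q m) (pos-^ q n) (pos-^ q 2) refl
           ineq
  where
  q = suc q′
  P = q ^ m
  B≤P² : ballSize q′ n m t′ ≤ P ℕ.* P
  e = m ℕ.* n ∸ m ℕ.* 2
  B≤P² = cancel-power q′ (e ℕ.+ t′) (ℕP.≤-trans packing (ℕP.≤-reflexive split))
    where
    rearrange : ∀ E P Q → E ℕ.* (P ℕ.* (P ℕ.* 1)) ℕ.* Q ≡ E ℕ.* Q ℕ.* (P ℕ.* P)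
    rearrange = solve-∀
    split : (q ^ m) ^ n ℕ.* q ^ t′ ≡ q ^ (e ℕ.+ t′) ℕ.* (P ℕ.* P)
    split = begin
      (q ^ m) ^ n ℕ.* q ^ t′               ≡⟨ cong (ℕ._* q ^ t′) (ℕP.^-*-assoc q m n) ⟩
      q ^ (m ℕ.* n) ℕ.* q ^ t′             ≡⟨ cong (λ k → q ^ k ℕ.* q ^ t′) (≡.sym (ℕP.m∸n+n≡m (ℕP.*-monoʳ-≤ m (ℕP.<⇒≤ 2<n)))) ⟩
      q ^ (e ℕ.+ m ℕ.* 2) ℕ.* q ^ t′       ≡⟨ cong (ℕ._* q ^ t′) (ℕP.^-distribˡ-+-* q e (m ℕ.* 2)) ⟩
      q ^ e ℕ.* q ^ (m ℕ.* 2) ℕ.* q ^ t′   ≡⟨ cong (λ x → q ^ e ℕ.* x ℕ.* q ^ t′) (≡.sym (ℕP.^-*-assoc q m 2)) ⟩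
      q ^ e ℕ.* (P ℕ.* (P ℕ.* 1)) ℕ.* q ^ t′ ≡⟨ rearrange (q ^ e) P (q ^ t′) ⟩
      q ^ e ℕ.* q ^ t′ ℕ.* (P ℕ.* P)       ≡⟨ cong (ℕ._* (P ℕ.* P)) (≡.sym (ℕP.^-distribˡ-+-* q e t′)) ⟩
      q ^ (e ℕ.+ t′) ℕ.* (P ℕ.* P)         ∎
      where open ≡.≡-Reasoning
  ineq : suc t′ ℕ.* q′ ^ 2 ℕ.+ (q ^ (2 ℕ.* m) ℕ.+ q ^ (m ℕ.+ n) ℕ.+ 3 ℕ.* q)
         ≤ q ^ (2 ℕ.* m ℕ.+ 1) ℕ.+ q ^ m ℕ.+ q ^ n ℕ.+ q ^ 2 ℕ.+ 1
  ineq rewrite ^-double-suc q m | ^-double q m | ℕP.^-distribˡ-+-* q m n =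
    ballSize≤P²⇒ineq₃ q′ (projPoints q m) (projPoints q n) t′ {q ^ m} {q ^ n}
      (≡.sym (suc[q′*projPoints]≡q^ q′ m)) (≡.sym (suc[q′*projPoints]≡q^ q′ n)) B≤P²

theorem6p1 : ∀ {c ℓ : Level} (F : CommutativeRing c ℓ) (q : ℕ)
    → IsField F → HasSize F q
    → (t m n : ℕ) → 1 ≤ t → n ≤ m → 1 ≤ n
    → Σ (Code F {t} (firstThen1 n) (firstThen1 m) 3) (IsMSRD F q)
    → ((n ≡ 1) → (+ t) ℤ.≤ (+ 1) ℤ.+ (+ q) ℤ.^ m)
    × ((n ≡ 2) → (+ t) ℤ.* ((+ q) ℤ.- (+ 1))
                   ℤ.≤ (+ q) ℤ.^ (2 ℕ.* m) ℤ.- (+ q) ℤ.^ (suc m) ℤ.- (+ q) ℤ.^ m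
                       ℤ.+ (+ 2) ℤ.* (+ q) ℤ.- (+ 1))
    × ((n > 2) → (+ t) ℤ.* (((+ q) ℤ.- (+ 1)) ℤ.^ 2)
                   ℤ.≤ (+ q) ℤ.^ (2 ℕ.* m ℕ.+ 1) ℤ.- (+ q) ℤ.^ (2 ℕ.* m)
                       ℤ.- (+ q) ℤ.^ (m ℕ.+ n) ℤ.+ (+ q) ℤ.^ m ℤ.+ (+ q) ℤ.^ n
                       ℤ.+ (+ q) ℤ.^ 2 ℤ.- (+ 3) ℤ.* (+ q) ℤ.+ (+ 1))
theorem6p1 F q isField hasSize t m n 1≤t _ _ (C , msrd) with fieldSize≥2 F isField hasSize | 1≤t
... | s≤s (s≤s {n = q″} _) | s≤s {n = t′} _ = n≡1 , n≡2 , n>2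
  where
  open SpherePacking F isField hasSize n m t′ C using (sphere-packing)
  packing : ∀ {e} → singletonExp {suc t′} 2 (firstThen1 n) (firstThen1 m) ≡ e
          → suc (suc q″) ^ e ℕ.* ballSize (suc q″) n m t′ ≤ (suc (suc q″) ^ m) ^ n ℕ.* suc (suc q″) ^ t′
  packing exponent = ≡.subst (λ s → s ℕ.* _ ≤ _) (≡.trans msrd (cong (suc (suc q″) ^_) exponent)) sphere-packing
  n≡1 : n ≡ 1 → _
  n≡1 refl = packing⇒bound₁ (suc q″) m t′ (packing (singletonExp-ones t′ 1))
  n≡2 : n ≡ 2 → _
  n≡2 refl = packing⇒bound₂ (suc q″) m t′ (packing (singletonExp-ones t′ 0))
  n>2 : n > 2 → _
  -- Matching on 2<n exposes n = 3 + n″, so that the test 2 <? n inside singletonExp computes.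
  n>2 2<n@(s≤s (s≤s (s≤s _))) =
    packing⇒bound₃ (suc q″) m n t′ 2<n (packing (cong (m ℕ.* n ∸ m ℕ.* 2 ℕ.+_) (∑ℕ-ones t′)))
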